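{- Let $m>0$ be an integer and $q\in\{0,1\}$. Let $G=\langle x,y,z : x^{2m+q}=y^2=z^2=1,\ xy=yx,\ xz=zx,\ yz=zy\rangle\cong \mathbb{Z}_2^2\times\mathbb{Z}_{2m+q}$, a group of order $8m+4q$, and let $L_{8m+4q}$ be its Cayley table (rows and columns indexed by $G$, cell $(r,c)$ containing $rc$). Let $$L^*_{8m+4q}=\big(L_{8m+4q}\setminus\{(1,1,1),(1,y,y),(y,1,y),(y,y,1)\}\big)\cup\{(1,1,y),(1,y,1),(y,1,1),(y,y,y)\}.$$ Then $L^*_{8m+4q}$ is omniversal.
   Context: Latin squares are viewed as sets of triples $(r,c,s)$ with $s$ the symbol in cell $(r,c)$. A partial transversal is a set of triples containing at most one triple in each row, at most one in each column, and at most one with each symbol; its length is its number of triples. It is maximal if not contained in a longer partial transversal. A Latin square of order $n$ is omniversal if it has a maximal partial transversal of every length $\ell$ with $\lceil n/2\rceil\le\ell\le n$. -}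

module Defs where

open import Data.Nat using (ℕ; zero; suc; _+_; _*_; _≤_; _<_; _%_; ⌈_/2⌉)
open import Data.Nat.DivMod using (m%n<n)
open import Data.Fin using (Fin; toℕ; fromℕ<)
open import Data.Product using (_×_; _,_; Σ; ∃-syntax)
open import Data.Sum using (_⊎_)
open import Data.List using (List; length)
open import Data.List.Membership.Propositional using (_∈_)
open import Relation.Binary.PropositionalEquality using (_≡_)
open import Relation.Nullary using (¬_)

-- Latin squares as sets of triples (r , c , s) over a carrier A

Triple : Set → Set
Triple A = A × A × A

Square : Set → Set₁
Square A = Triple A → Set

row col sym : {A : Set} → Triple A → A
row (r , c , s) = r
col (r , c , s) = c
sym (r , c , s) = s

open import Data.List.Relation.Unary.Unique.Propositional using (Unique)

record IsPartialTransversal {A : Set} (L : Square A) (T : List (Triple A)) : Set where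
  field
    inL      : ∀ {t} → t ∈ T → L t
    rowsUniq : ∀ {t u} → t ∈ T → u ∈ T → row t ≡ row u → t ≡ u
    colsUniq : ∀ {t u} → t ∈ T → u ∈ T → col t ≡ col u → t ≡ u
    symsUniq : ∀ {t u} → t ∈ T → u ∈ T → sym t ≡ sym u → t ≡ u
    -- the list has no repeated entries, so its length is the number of triples
    noDup    : Unique T

_⊆_ : {A : Set} → List A → List A → Set
T ⊆ U = ∀ {t} → t ∈ T → t ∈ U

MaximalPT : {A : Set} → Square A → List (Triple A) → Set
MaximalPT {A} L T =
  IsPartialTransversal L T ×
  (∀ (U : List (Triple A)) → IsPartialTransversal L U → T ⊆ U → length U ≤ length T)

Omniversal : {A : Set} → (n : ℕ) → Square A → Set
Omniversal {A} n L =
  ∀ ℓ → ⌈ n /2⌉ ≤ ℓ → ℓ ≤ n →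
    ∃[ T ] (MaximalPT L T × length T ≡ ℓ)

addMod : (k : ℕ) → Fin k → Fin k → Fin k
addMod (suc k) a b = fromℕ< (m%n<n (toℕ a + toℕ b) (suc k))

-- elements (y-exponent , z-exponent , x-exponent)
G : ℕ → Set
G k = Fin 2 × Fin 2 × Fin k

mul : (k : ℕ) → G k → G k → G k
mul k (a , b , c) (a' , b' , c') = addMod 2 a a' , addMod 2 b b' , addMod k c c'

IsOne : {k : ℕ} → G k → Set
IsOne (a , b , c) = toℕ a ≡ 0 × toℕ b ≡ 0 × toℕ c ≡ 0

IsY : {k : ℕ} → G k → Set
IsY (a , b , c) = toℕ a ≡ 1 × toℕ b ≡ 0 × toℕ c ≡ 0

Cayley : (k : ℕ) → Square (G k)
Cayley k (r , c , s) = s ≡ mul k r c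

Removed : {k : ℕ} → Triple (G k) → Set
Removed (r , c , s) =
  (IsOne r × IsOne c × IsOne s) ⊎ (IsOne r × IsY c × IsY s) ⊎
  (IsY r × IsOne c × IsY s) ⊎ (IsY r × IsY c × IsOne s)

Added : {k : ℕ} → Triple (G k) → Set
Added (r , c , s) =
  (IsOne r × IsOne c × IsY s) ⊎ (IsOne r × IsY c × IsOne s) ⊎
  (IsY r × IsOne c × IsOne s) ⊎ (IsY r × IsY c × IsY s)

LStar : (k : ℕ) → Square (G k)
LStar k t = (Cayley k t × ¬ Removed t) ⊎ Added t

-- Write k = 2m + q and G = V × ℤ_k with V = ⟨y⟩ × ⟨z⟩, and call the rows (columns) of
-- x-exponent i block i. A partial transversal is assembled block by block: a pattern leaves each
-- row of block i unused or joins it to a column of block i + d + c (d, c ∈ {0, 1}), and the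
-- symbol then has x-exponent 2i + d + c. The slots 2i + d run through [0, 2k) and meet every
-- residue modulo k twice, exactly once inside the window [q, k + q); as k + q is even, both slots
-- of a block i ≥ 1 lie on the same side of it. The Klein parts of the symbols are taken from one
-- class of a partition of V inside the window and from the other class outside it, so no symbol
-- repeats. Maximality holds because the Klein parts of unused rows and columns multiply into
-- Klein parts of symbols occurring in every x-exponent, while the four altered cells of L* are
-- blocked through their columns. Blocks using 4 or 2 rows, after a suitable block 0, give every
-- length from 2k to 4k; the finitely many conditions on the patterns are decided by evaluation,
-- and the order 8 is settled by explicit transversals.

module Submission where

open import Defs
open import Data.Bool using (Bool; true; false; _∧_; not; if_then_else_)
import Data.Bool.Properties as Bool
open import Data.Empty using (⊥-elim)
open import Data.Fin using (Fin; zero; suc; toℕ; fromℕ<; combine)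
open import Data.Fin.Patterns using (0F; 1F)
import Data.Fin.Properties as Fin
open import Data.Fin.Properties
  using (injective⇒≤; toℕ-fromℕ<; toℕ-injective; toℕ<n; toℕ-combine; combine-injective; combine-surjective)
open import Data.List
  using (List; []; _∷_; _++_; length; lookup; map; mapMaybe; allFin; tabulate; cartesianProduct; cartesianProductWith)
open import Data.List.Membership.Propositional using (_∈_; find; lose)
open import Data.List.Membership.Propositional.Properties
  using (∈-lookup; ∈-allFin; ∈-cartesianProduct⁺; ∈-cartesianProductWith⁺)
open import Data.List.Properties using (mapMaybe-++; length-++)
open import Data.List.Relation.Unary.All as All using (All; []; _∷_)
open import Data.List.Relation.Unary.AllPairs using (AllPairs; []; _∷_; allPairs?)
open import Data.List.Relation.Unary.Any as Any using (Any; index; here; there)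
open import Data.List.Relation.Unary.Any.Properties using (lookup-index)
open import Data.List.Relation.Unary.Unique.Propositional using (Unique)
open import Data.List.Relation.Unary.Unique.Propositional.Properties using (cartesianProductWith⁺; allFin⁺)
open import Data.Maybe using (Maybe; just; nothing)
import Data.Maybe as Maybe
import Data.Maybe.Properties as Maybe
open import Data.Nat using (ℕ; zero; suc; pred; _+_; _*_; _∸_; _≤_; _<_; _%_; z≤n; s≤s; _≤?_; _<?_; ⌈_/2⌉)
open import Data.Nat.DivMod using (m%n<n; m<n⇒m%n≡m; [m+n]%n≡m%n; %-distribˡ-+; m%n%n≡m%n)
open import Data.Nat.ListAction using (sum)
open import Data.Nat.Properties
open import Data.Nat.Tactic.RingSolver using (solve-∀)
open import Data.Product using (_×_; _,_; ∃)
open import Data.Product.Properties using (≡-dec)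
open import Data.Sum using (_⊎_; inj₁; inj₂)
open import Data.Unit using (tt)
open import Function using (id; _∘_)
open import Relation.Binary.Definitions using (DecidableEquality)
open import Relation.Binary.PropositionalEquality as ≡
  using (_≡_; _≢_; refl; cong; cong₂; trans; subst; module ≡-Reasoning)
open import Relation.Nullary using (¬_; Dec; yes; no)
open import Relation.Nullary.Decidable using (⌊_⌋; toWitness; map′; _×-dec_; _→-dec_; _⊎-dec_; ¬?)

lookup-injective : {A : Set} (xs : List A) → Unique xs → ∀ i j → lookup xs i ≡ lookup xs j → i ≡ j
lookup-injective (x ∷ xs) u             zero    zero    e = refl
lookup-injective (x ∷ xs) (x∉xs ∷ u)    zero    (suc j) e = ⊥-elim (All.lookup x∉xs (∈-lookup j) e)
lookup-injective (x ∷ xs) (x∉xs ∷ u)    (suc i) zero    e = ⊥-elim (All.lookup x∉xs (∈-lookup i) (≡.sym e))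
lookup-injective (x ∷ xs) (_ ∷ u)       (suc i) (suc j) e = cong suc (lookup-injective xs u i j e)

Unique⇒length-≤ : {A : Set} {xs ys : List A} → Unique xs → xs ⊆ ys → length xs ≤ length ys
Unique⇒length-≤ {xs = xs} {ys} u xs⊆ys = injective⇒≤ position-injective
  where
    position : Fin (length xs) → Fin (length ys)
    position i = index (xs⊆ys (∈-lookup i))
    position-injective : ∀ {i j} → position i ≡ position j → i ≡ j
    position-injective {i} {j} e = lookup-injective xs u i j
      (trans (lookup-index (xs⊆ys (∈-lookup i)))
        (trans (cong (lookup ys) e) (≡.sym (lookup-index (xs⊆ys (∈-lookup j))))))

SharesLine : {A : Set} → A → A → A → Triple A → Set
SharesLine r c s t = row t ≡ r ⊎ col t ≡ c ⊎ sym t ≡ s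

module _ {A : Set} {L : Square A} (symbolAt : A → A → A)
         (L⇒symbolAt : ∀ {r c s} → L (r , c , s) → s ≡ symbolAt r c) where

  -- A triple of a larger partial transversal coincides with the triple of T it meets.
  maximal-if-blocking : ∀ {T} → IsPartialTransversal L T →
    (∀ r c → Any (SharesLine r c (symbolAt r c)) T) → MaximalPT L T
  maximal-if-blocking {T} PT blocks = PT , λ U PU T⊆U → Unique⇒length-≤ (noDup PU) (U⊆T PU T⊆U)
    where
      open IsPartialTransversal
      U⊆T : ∀ {U} → IsPartialTransversal L U → T ⊆ U → U ⊆ T
      U⊆T PU T⊆U {u@(r , c , s)} u∈U with find (blocks r c)
      ... | t , t∈T , inj₁ e        = subst (_∈ T) (rowsUniq PU (T⊆U t∈T) u∈U e) t∈T
      ... | t , t∈T , inj₂ (inj₁ e) = subst (_∈ T) (colsUniq PU (T⊆U t∈T) u∈U e) t∈T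
      ... | t , t∈T , inj₂ (inj₂ e) = subst (_∈ T) (symsUniq PU (T⊆U t∈T) u∈U
                                         (trans e (≡.sym (L⇒symbolAt (inL PU u∈U))))) t∈T

  module Certificates (_≟_ : DecidableEquality A) (elements : List A) (complete : ∀ a → a ∈ elements)
                      (symbolAt∈L : ∀ r c → L (r , c , symbolAt r c)) where

    _≟₃_ : DecidableEquality (Triple A)
    _≟₃_ = ≡-dec _≟_ (≡-dec _≟_ _≟_)

    UniqueOn : (Triple A → A) → List (Triple A) → Set
    UniqueOn line T = All (λ t → All (λ u → line t ≡ line u → t ≡ u) T) T

    Certificate : List (Triple A) → Set
    Certificate T = All (λ t → sym t ≡ symbolAt (row t) (col t)) T
                  × UniqueOn row T × UniqueOn col T × UniqueOn sym T
                  × AllPairs (λ t u → ¬ t ≡ u) T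
                  × All (λ r → All (λ c → Any (SharesLine r c (symbolAt r c)) T) elements) elements

    certificate? : ∀ T → Dec (Certificate T)
    certificate? T = All.all? (λ t → sym t ≟ symbolAt (row t) (col t)) T
      ×-dec uniqueOn? row ×-dec uniqueOn? col ×-dec uniqueOn? sym
      ×-dec allPairs? (λ t u → ¬? (t ≟₃ u)) T
      ×-dec All.all? (λ r → All.all? (λ c → Any.any? (λ t →
              (row t ≟ r) ⊎-dec (col t ≟ c) ⊎-dec (sym t ≟ symbolAt r c)) T) elements) elements
      where
        uniqueOn? : ∀ line → Dec (UniqueOn line T)
        uniqueOn? line = All.all? (λ t → All.all? (λ u → (line t ≟ line u) →-dec (t ≟₃ u)) T) T

    certificate⇒maximal : ∀ {T} → Certificate T → MaximalPT L T
    certificate⇒maximal {T} (symbols , rows , cols , syms , distinct , blocking) =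
      maximal-if-blocking PT (λ r c → All.lookup (All.lookup blocking (complete r)) (complete c))
      where
        PT : IsPartialTransversal L T
        PT = record
          { inL      = λ {t} t∈T → subst (λ s → L (row t , col t , s)) (≡.sym (All.lookup symbols t∈T))
                                     (symbolAt∈L (row t) (col t))
          ; rowsUniq = λ t∈T u∈T → All.lookup (All.lookup rows t∈T) u∈T
          ; colsUniq = λ t∈T u∈T → All.lookup (All.lookup cols t∈T) u∈T
          ; symsUniq = λ t∈T u∈T → All.lookup (All.lookup syms t∈T) u∈T
          ; noDup    = distinct }

module _ {A B : Set} (f : A → Maybe B) where

  ∈-mapMaybe⁺ : ∀ {xs x b} → x ∈ xs → f x ≡ just b → b ∈ mapMaybe f xs
  ∈-mapMaybe⁺ {x ∷ xs} (here refl) fx≡b with f x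
  ∈-mapMaybe⁺ {x ∷ xs} (here refl) refl | just b = here refl
  ∈-mapMaybe⁺ {x ∷ xs} (there x∈xs) fx≡b with f x
  ... | just _  = there (∈-mapMaybe⁺ x∈xs fx≡b)
  ... | nothing = ∈-mapMaybe⁺ x∈xs fx≡b

  ∈-mapMaybe⁻ : ∀ xs {b} → b ∈ mapMaybe f xs → ∃ λ x → x ∈ xs × f x ≡ just b
  ∈-mapMaybe⁻ (x ∷ xs) b∈ with f x in fx
  ∈-mapMaybe⁻ (x ∷ xs) (here refl) | just _ = x , here refl , fx
  ∈-mapMaybe⁻ (x ∷ xs) (there b∈)  | just _ with ∈-mapMaybe⁻ xs b∈
  ... | x' , x'∈xs , fx' = x' , there x'∈xs , fx'
  ∈-mapMaybe⁻ (x ∷ xs) b∈ | nothing with ∈-mapMaybe⁻ xs b∈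
  ... | x' , x'∈xs , fx' = x' , there x'∈xs , fx'

  Unique-mapMaybe : (∀ {x x' b} → f x ≡ just b → f x' ≡ just b → x ≡ x') →
                    ∀ {xs} → Unique xs → Unique (mapMaybe f xs)
  Unique-mapMaybe f-injective {[]} [] = []
  Unique-mapMaybe f-injective {x ∷ xs} (x∉xs ∷ u) with f x in fx
  ... | just b  = All.tabulate (λ b∈ b≡b' → fresh b∈ b≡b') ∷ Unique-mapMaybe f-injective u
    where
      fresh : ∀ {b'} → b' ∈ mapMaybe f xs → b ≢ b'
      fresh b'∈ refl with ∈-mapMaybe⁻ xs b'∈
      ... | x' , x'∈xs , fx' = All.lookup x∉xs x'∈xs (f-injective fx fx')
  ... | nothing = Unique-mapMaybe f-injective u

  length-mapMaybe-map : {C : Set} (g : A → B → C) (xs : List A) →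
                        length (mapMaybe (λ x → Maybe.map (g x) (f x)) xs) ≡ length (mapMaybe f xs)
  length-mapMaybe-map g []       = refl
  length-mapMaybe-map g (x ∷ xs) with f x
  ... | just _  = cong suc (length-mapMaybe-map g xs)
  ... | nothing = length-mapMaybe-map g xs

isZero : ∀ {n} → Fin n → Bool
isZero zero    = true
isZero (suc _) = false

flip : Fin 2 → Fin 2
flip zero       = suc zero
flip (suc zero) = zero

_⊕_ : Fin 2 → Fin 2 → Fin 2
zero     ⊕ b = b
suc zero ⊕ b = flip b

addMod2≡⊕ : ∀ a b → addMod 2 a b ≡ a ⊕ b
addMod2≡⊕ zero       zero       = refl
addMod2≡⊕ zero       (suc zero) = refl
addMod2≡⊕ (suc zero) zero       = refl
addMod2≡⊕ (suc zero) (suc zero) = refl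

oneOrY : ∀ {k} → G k → Bool
oneOrY (_ , b , i) = isZero b ∧ isZero i

addYIf : ∀ {k} → Bool → G k → G k
addYIf false g           = g
addYIf true  (a , b , i) = flip a , b , i

-- L* is the Cayley table with the symbols of the cells r , c ∈ {1 , y} multiplied by y.
symbol : (k : ℕ) → G k → G k → G k
symbol k r c = addYIf (oneOrY r ∧ oneOrY c) (mul k r c)

data OneOrY {k} : G (suc k) → Set where
  is-one : OneOrY (zero , zero , zero)
  is-y   : OneOrY (suc zero , zero , zero)

oneOrY? : ∀ {k} (r : G (suc k)) → OneOrY r ⊎ oneOrY r ≡ false
oneOrY? (zero     , zero     , zero)  = inj₁ is-one
oneOrY? (suc zero , zero     , zero)  = inj₁ is-y
oneOrY? (_        , zero     , suc _) = inj₂ refl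
oneOrY? (_        , suc zero , _)     = inj₂ refl

IsOne⇒OneOrY : ∀ {k} {r : G (suc k)} → IsOne r → OneOrY r
IsOne⇒OneOrY {r = zero , zero     , zero}  _ = is-one
IsOne⇒OneOrY {r = _    , suc zero , _}     (_ , () , _)
IsOne⇒OneOrY {r = _    , zero     , suc _} (_ , _ , ())

IsY⇒OneOrY : ∀ {k} {r : G (suc k)} → IsY r → OneOrY r
IsY⇒OneOrY {r = suc zero , zero     , zero}  _ = is-y
IsY⇒OneOrY {r = zero     , _        , _}     (() , _ , _)
IsY⇒OneOrY {r = _        , suc zero , _}     (_ , () , _)
IsY⇒OneOrY {r = _        , zero     , suc _} (_ , _ , ())

symbol-off-corner : ∀ k (r c : G k) → oneOrY r ≡ false ⊎ oneOrY c ≡ false → symbol k r c ≡ mul k r c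
symbol-off-corner k r c (inj₁ e) rewrite e = refl
symbol-off-corner k r c (inj₂ e) rewrite e with oneOrY r
... | true  = refl
... | false = refl

isOne : ∀ {k} → IsOne {suc k} (zero , zero , zero)
isOne = refl , refl , refl

isY : ∀ {k} → IsY {suc k} (suc zero , zero , zero)
isY = refl , refl , refl

Removed⇒corner : ∀ {k} {r c s : G (suc k)} → Removed (r , c , s) → OneOrY r × OneOrY c
Removed⇒corner (inj₁ (r1 , c1 , _))               = IsOne⇒OneOrY r1 , IsOne⇒OneOrY c1
Removed⇒corner (inj₂ (inj₁ (r1 , cy , _)))        = IsOne⇒OneOrY r1 , IsY⇒OneOrY cy
Removed⇒corner (inj₂ (inj₂ (inj₁ (ry , c1 , _)))) = IsY⇒OneOrY ry , IsOne⇒OneOrY c1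
Removed⇒corner (inj₂ (inj₂ (inj₂ (ry , cy , _)))) = IsY⇒OneOrY ry , IsY⇒OneOrY cy

OneOrY⇒¬false : ∀ {k} {r : G (suc k)} → OneOrY r → ¬ oneOrY r ≡ false
OneOrY⇒¬false is-one ()
OneOrY⇒¬false is-y   ()

off-corner∈LStar : ∀ k (r c : G (suc k)) → oneOrY r ≡ false ⊎ oneOrY c ≡ false →
                   LStar (suc k) (r , c , symbol (suc k) r c)
off-corner∈LStar k r c off = inj₁ (symbol-off-corner (suc k) r c off , not-removed off ∘ Removed⇒corner)
  where
    not-removed : oneOrY r ≡ false ⊎ oneOrY c ≡ false → ¬ (OneOrY r × OneOrY c)
    not-removed (inj₁ r-off) (r-on , _) = OneOrY⇒¬false r-on r-off
    not-removed (inj₂ c-off) (_ , c-on) = OneOrY⇒¬false c-on c-off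

symbol∈LStar : ∀ k (r c : G (suc k)) → LStar (suc k) (r , c , symbol (suc k) r c)
symbol∈LStar k r c with oneOrY? r | oneOrY? c
... | inj₁ is-one | inj₁ is-one = inj₂ (inj₁ (isOne {k} , isOne {k} , isY {k}))
... | inj₁ is-one | inj₁ is-y   = inj₂ (inj₂ (inj₁ (isOne {k} , isY {k} , isOne {k})))
... | inj₁ is-y   | inj₁ is-one = inj₂ (inj₂ (inj₂ (inj₁ (isY {k} , isOne {k} , isOne {k}))))
... | inj₁ is-y   | inj₁ is-y   = inj₂ (inj₂ (inj₂ (inj₂ (isY {k} , isY {k} , isY {k}))))
... | inj₂ r-off  | _           = off-corner∈LStar k r c (inj₁ r-off)
... | inj₁ _      | inj₂ c-off  = off-corner∈LStar k r c (inj₂ c-off)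

LStar⇒symbol : ∀ k {r c s : G (suc k)} → LStar (suc k) (r , c , s) → s ≡ symbol (suc k) r c
LStar⇒symbol k (inj₂ (inj₁ (r1 , c1 , sy)))
  with IsOne⇒OneOrY r1 | IsOne⇒OneOrY c1 | IsY⇒OneOrY sy
... | is-one | is-one | is-y = refl
LStar⇒symbol k (inj₂ (inj₂ (inj₁ (r1 , cy , s1))))
  with IsOne⇒OneOrY r1 | IsY⇒OneOrY cy | IsOne⇒OneOrY s1
... | is-one | is-y | is-one = refl
LStar⇒symbol k (inj₂ (inj₂ (inj₂ (inj₁ (ry , c1 , s1)))))
  with IsY⇒OneOrY ry | IsOne⇒OneOrY c1 | IsOne⇒OneOrY s1
... | is-y | is-one | is-one = refl
LStar⇒symbol k (inj₂ (inj₂ (inj₂ (inj₂ (ry , cy , sy)))))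
  with IsY⇒OneOrY ry | IsY⇒OneOrY cy | IsY⇒OneOrY sy
... | is-y | is-y | is-y = refl
LStar⇒symbol k {r} {c} (inj₁ (refl , not-removed)) with oneOrY? r | oneOrY? c
... | inj₁ is-one | inj₁ is-one = ⊥-elim (not-removed (inj₁ (isOne {k} , isOne {k} , isOne {k})))
... | inj₁ is-one | inj₁ is-y   = ⊥-elim (not-removed (inj₂ (inj₁ (isOne {k} , isY {k} , isY {k}))))
... | inj₁ is-y   | inj₁ is-one = ⊥-elim (not-removed (inj₂ (inj₂ (inj₁ (isY {k} , isOne {k} , isY {k})))))
... | inj₁ is-y   | inj₁ is-y   = ⊥-elim (not-removed (inj₂ (inj₂ (inj₂ (isY {k} , isY {k} , isOne {k})))))
... | inj₂ r-off  | _           = ≡.sym (symbol-off-corner (suc k) r c (inj₁ r-off))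
... | inj₁ _      | inj₂ c-off  = ≡.sym (symbol-off-corner (suc k) r c (inj₂ c-off))

module Residues (n : ℕ) where

  k : ℕ
  k = suc n

  [_] : ℕ → Fin k
  [ x ] = fromℕ< (m%n<n x k)

  toℕ-[] : ∀ x → toℕ [ x ] ≡ x % k
  toℕ-[] x = toℕ-fromℕ< (m%n<n x k)

  []-cong : ∀ x y → x % k ≡ y % k → [ x ] ≡ [ y ]
  []-cong x y e = toℕ-injective (trans (toℕ-[] x) (trans e (≡.sym (toℕ-[] y))))

  []-injective : ∀ {x y} → [ x ] ≡ [ y ] → x % k ≡ y % k
  []-injective {x} {y} e = trans (≡.sym (toℕ-[] x)) (trans (cong toℕ e) (toℕ-[] y))

  toℕ%k : ∀ (i : Fin k) → toℕ i % k ≡ toℕ i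
  toℕ%k i = m<n⇒m%n≡m (toℕ<n i)

  [toℕ] : ∀ (i : Fin k) → [ toℕ i ] ≡ i
  [toℕ] i = toℕ-injective (trans (toℕ-[] (toℕ i)) (toℕ%k i))

  %-injective : ∀ {x y} → x < k → y < k → x % k ≡ y % k → x ≡ y
  %-injective {x} {y} x<k y<k e = trans (≡.sym (m<n⇒m%n≡m x<k)) (trans e (m<n⇒m%n≡m y<k))

  k+x%k : ∀ x → (k + x) % k ≡ x % k
  k+x%k x = trans (cong (_% k) (+-comm k x)) ([m+n]%n≡m%n x k)

  %-congʳ-+ : ∀ x y z → x % k ≡ y % k → (x + z) % k ≡ (y + z) % k
  %-congʳ-+ x y z e =
    trans (%-distribˡ-+ x z k) (trans (cong (λ w → (w + z % k) % k) e) (≡.sym (%-distribˡ-+ y z k)))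

  []-+ : ∀ x y → [ toℕ [ x ] + y ] ≡ [ x + y ]
  []-+ x y = []-cong (toℕ [ x ] + y) (x + y)
    (%-congʳ-+ (toℕ [ x ]) x y (trans (cong (_% k) (toℕ-[] x)) (m%n%n≡m%n x k)))

  [x+k] : ∀ x → [ x + k ] ≡ [ x ]
  [x+k] x = []-cong (x + k) x ([m+n]%n≡m%n x k)

  []≡fromℕ< : ∀ {x} (x<k : x < k) → [ x ] ≡ fromℕ< x<k
  []≡fromℕ< {x} x<k =
    toℕ-injective (trans (toℕ-[] x) (trans (m<n⇒m%n≡m x<k) (≡.sym (toℕ-fromℕ< x<k))))

  %-cancelʳ-suc : ∀ a b → suc a % k ≡ suc b % k → a % k ≡ b % k
  %-cancelʳ-suc a b e = begin
    a % k           ≡⟨ ≡.sym ([m+n]%n≡m%n a k) ⟩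
    (a + k) % k     ≡⟨ cong (_% k) (+-suc a n) ⟩
    (suc a + n) % k ≡⟨ %-congʳ-+ (suc a) (suc b) n e ⟩
    (suc b + n) % k ≡⟨ cong (_% k) (≡.sym (+-suc b n)) ⟩
    (b + k) % k     ≡⟨ [m+n]%n≡m%n b k ⟩
    b % k           ∎
    where open ≡-Reasoning

  %-cancelʳ-+ : ∀ a b c → (a + c) % k ≡ (b + c) % k → a % k ≡ b % k
  %-cancelʳ-+ a b zero    e = ≡.subst₂ (λ x y → x % k ≡ y % k) (+-identityʳ a) (+-identityʳ b) e
  %-cancelʳ-+ a b (suc c) e = %-cancelʳ-+ a b c (%-cancelʳ-suc (a + c) (b + c)
    (≡.subst₂ (λ x y → x % k ≡ y % k) (+-suc a c) (+-suc b c) e))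

  data Below2k (x : ℕ) : Set where
    low  : x < k → Below2k x
    high : ∀ y → y < k → x ≡ k + y → Below2k x

  below2k : ∀ x → x < k + k → Below2k x
  below2k x x<2k with x <? k
  ... | yes x<k = low x<k
  ... | no  x≮k = high (x ∸ k) (+-cancelˡ-< k (x ∸ k) k (subst (_< k + k) x≡k+y x<2k)) x≡k+y
    where
      x≡k+y : x ≡ k + (x ∸ k)
      x≡k+y = ≡.sym (m+[n∸m]≡n (≮⇒≥ x≮k))

  same-residue-below-2k : ∀ x y → x < k + k → y < k + k → x % k ≡ y % k →
                          x ≡ y ⊎ (∃ λ z → z < k × (x ≡ z × y ≡ k + z ⊎ y ≡ z × x ≡ k + z))
  same-residue-below-2k x y x<2k y<2k e with below2k x x<2k | below2k y y<2k
  ... | low x<k | low y<k =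
    inj₁ (%-injective x<k y<k e)
  ... | low x<k | high y' y'<k refl =
    inj₂ (x , x<k , inj₁ (refl , cong (k +_) (≡.sym (%-injective x<k y'<k (trans e (k+x%k y'))))))
  ... | high x' x'<k refl | low y<k =
    inj₂ (y , y<k , inj₂ (refl , cong (k +_) (%-injective x'<k y<k (trans (≡.sym (k+x%k x')) e))))
  ... | high x' x'<k refl | high y' y'<k refl =
    inj₁ (cong (k +_) (%-injective x'<k y'<k (trans (≡.sym (k+x%k x')) (trans e (k+x%k y')))))

  module Window (q : ℕ) (q≤1 : q ≤ 1) where

    inWindow : ℕ → Bool
    inWindow x = ⌊ q ≤? x ⌋ ∧ ⌊ x <? k + q ⌋

    inWindow-low : ∀ x → x < k → inWindow x ≡ ⌊ q ≤? x ⌋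
    inWindow-low x x<k with q ≤? x | x <? k + q
    ... | yes _ | yes _    = refl
    ... | yes _ | no x≮k+q = ⊥-elim (x≮k+q (≤-trans x<k (m≤m+n k q)))
    ... | no _  | _        = refl

    inWindow-high : ∀ x → x < k → inWindow (k + x) ≡ ⌊ x <? q ⌋
    inWindow-high x x<k with q ≤? k + x | k + x <? k + q | x <? q
    ... | yes _   | yes _ | yes _   = refl
    ... | yes _   | yes p | no x≮q  = ⊥-elim (x≮q (+-cancelˡ-< k x q p))
    ... | yes _   | no ¬p | yes x<q = ⊥-elim (¬p (+-monoʳ-< k x<q))
    ... | yes _   | no _  | no _    = refl
    ... | no q≰k+x | _    | _       = ⊥-elim (q≰k+x (≤-trans q≤1 (≤-trans (s≤s z≤n) (m≤m+n k x))))

    inWindow-low≢high : ∀ x → x < k → inWindow x ≢ inWindow (k + x)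
    inWindow-low≢high x x<k e with trans (≡.sym (inWindow-low x x<k)) (trans e (inWindow-high x x<k))
    ... | e' with q ≤? x | x <? q
    ...   | yes q≤x | yes x<q = <⇒≱ x<q q≤x
    ...   | no q≰x  | no x≮q  = q≰x (≮⇒≥ x≮q)

    inWindow-unique : ∀ x y → x < k + k → y < k + k → x % k ≡ y % k → inWindow x ≡ inWindow y → x ≡ y
    inWindow-unique x y x<2k y<2k e w with same-residue-below-2k x y x<2k y<2k e
    ... | inj₁ x≡y = x≡y
    ... | inj₂ (z , z<k , inj₁ (refl , refl)) = ⊥-elim (inWindow-low≢high z z<k w)
    ... | inj₂ (z , z<k , inj₂ (refl , refl)) = ⊥-elim (inWindow-low≢high z z<k (≡.sym w))

    inWindow-hit : ∀ t w → ∃ λ x → x < k + k × x % k ≡ t % k × inWindow x ≡ w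
    inWindow-hit t w with inWindow (t % k) Bool.≟ w
    ... | yes in-w = t % k , ≤-trans (m%n<n t k) (m≤m+n k k) , m%n%n≡m%n t k , in-w
    ... | no  out-w =
      k + t % k , +-monoʳ-< k (m%n<n t k) , trans (k+x%k (t % k)) (m%n%n≡m%n t k) , other out-w
      where
        other : inWindow (t % k) ≢ w → inWindow (k + t % k) ≡ w
        other t≢w with inWindow (k + t % k) Bool.≟ w
        ... | yes e = e
        ... | no k+t≢w = ⊥-elim (inWindow-low≢high (t % k) (m%n<n t k)
                           (trans (Bool.¬-not t≢w) (≡.sym (Bool.¬-not k+t≢w))))

    inWindow-0 : inWindow 0 ≡ ⌊ q ≤? 0 ⌋
    inWindow-0 = inWindow-low 0 (s≤s z≤n)

    inWindow-1 : 1 ≤ n → inWindow 1 ≡ true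
    inWindow-1 1≤n with q ≤? 1 | 1 <? k + q
    ... | yes _ | yes _ = refl
    ... | no q≰1 | _ = ⊥-elim (q≰1 q≤1)
    ... | yes _ | no 1≮k+q = ⊥-elim (1≮k+q (≤-trans (s≤s 1≤n) (m≤m+n k q)))

    -- For even k + q the window boundaries are even, so 2i and 2i + 1 are never separated.
    inWindow-pair : ∀ h → k + q ≡ h + h → ∀ i → 1 ≤ i → inWindow (i + i) ≡ inWindow (i + i + 1)
    inWindow-pair h k+q≡h+h i 1≤i with q ≤? i + i | q ≤? i + i + 1 | i + i <? k + q | i + i + 1 <? k + q
    ... | yes _ | yes _ | yes _ | yes _ = refl
    ... | yes _ | yes _ | no _  | no _  = refl
    ... | yes _ | yes _ | yes lt | no ≮ = ⊥-elim (≮ (subst (i + i + 1 <_) (≡.sym k+q≡h+h)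
                                            (double<⇒suc-double< (subst (i + i <_) k+q≡h+h lt))))
      where
        double<⇒suc-double< : i + i < h + h → i + i + 1 < h + h
        double<⇒suc-double< lt with i <? h
        ... | yes i<h = subst (_≤ h + h) (cong suc (trans (+-suc i i) (+-comm 1 (i + i)))) (+-mono-≤ i<h i<h)
        ... | no i≮h  = ⊥-elim (<⇒≱ lt (+-mono-≤ (≮⇒≥ i≮h) (≮⇒≥ i≮h)))
    ... | yes _ | yes _ | no ≮ | yes lt = ⊥-elim (≮ (<-trans (n<1+n (i + i)) (subst (_< k + q) (+-comm (i + i) 1) lt)))
    ... | yes q≤ | no q≰ | _ | _ = ⊥-elim (q≰ (≤-trans q≤ (m≤m+n (i + i) 1)))
    ... | no q≰ | _ | _ | _ = ⊥-elim (q≰ (≤-trans q≤1 (≤-trans 1≤i (m≤m+n i i))))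

module Enumeration {A : Set} (elements : List A) (complete : ∀ a → a ∈ elements) where

  ∀? : {P : A → Set} → (∀ a → Dec (P a)) → Dec (∀ a → P a)
  ∀? p = map′ (λ all a → All.lookup all (complete a)) (λ f → All.tabulate (λ {a} _ → f a))
              (All.all? p elements)

  ∃? : {P : A → Set} → (∀ a → Dec (P a)) → Dec (∃ P)
  ∃? p = map′ Any.satisfied (λ (a , pa) → Any.map (λ { refl → pa }) (complete a))
              (Any.any? p elements)

-- The Klein part ⟨y⟩ × ⟨z⟩ of G k, as pairs of exponents.
V : Set
V = Fin 2 × Fin 2

_≟V_ : DecidableEquality V
_≟V_ = ≡-dec Fin._≟_ Fin._≟_

_⊞_ : V → V → V
(a , b) ⊞ (a' , b') = a ⊕ a' , b ⊕ b'

pattern e  = zero , zero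
pattern y  = suc zero , zero
pattern z  = zero , suc zero
pattern yz = suc zero , suc zero

Vs : List V
Vs = e ∷ z ∷ y ∷ yz ∷ []

V-complete : ∀ u → u ∈ Vs
V-complete e  = here refl
V-complete z  = there (here refl)
V-complete y  = there (there (here refl))
V-complete yz = there (there (there (here refl)))

Vs-unique : Unique Vs
Vs-unique = ((λ ()) ∷ (λ ()) ∷ (λ ()) ∷ []) ∷ ((λ ()) ∷ (λ ()) ∷ []) ∷ ((λ ()) ∷ []) ∷ [] ∷ []

Bools : List Bool
Bools = true ∷ false ∷ []

Bool-complete : ∀ b → b ∈ Bools
Bool-complete true  = here refl
Bool-complete false = there (here refl)

open Enumeration Vs V-complete renaming (∀? to ∀V?; ∃? to ∃V?)
open Enumeration Bools Bool-complete renaming (∀? to ∀B?) hiding (∃?)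

inY : V → Bool
inY (_ , b) = isZero b

yIf : Bool → V
yIf true  = y
yIf false = e

klein : ∀ {k} → G k → V
klein (a , b , _) = a , b

xPart : ∀ {k} → G k → Fin k
xPart (_ , _ , i) = i

⊕-identityʳ : ∀ a → a ⊕ zero ≡ a
⊕-identityʳ zero       = refl
⊕-identityʳ (suc zero) = refl

⊕-one : ∀ a → a ⊕ suc zero ≡ flip a
⊕-one zero       = refl
⊕-one (suc zero) = refl

klein-symbol : ∀ k (r c : G k) → klein (symbol k r c) ≡ (klein r ⊞ klein c) ⊞ yIf (oneOrY r ∧ oneOrY c)
klein-symbol k r@(a , b , _) c@(a' , b' , _) with oneOrY r ∧ oneOrY c
... | false rewrite addMod2≡⊕ a a' | addMod2≡⊕ b b' =
  ≡.sym (cong₂ _,_ (⊕-identityʳ (a ⊕ a')) (⊕-identityʳ (b ⊕ b')))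
... | true  rewrite addMod2≡⊕ a a' | addMod2≡⊕ b b' =
  ≡.sym (cong₂ _,_ (⊕-one (a ⊕ a')) (⊕-identityʳ (b ⊕ b')))

xPart-symbol : ∀ k (r c : G k) → xPart (symbol k r c) ≡ addMod k (xPart r) (xPart c)
xPart-symbol k r c with oneOrY r ∧ oneOrY c
... | false = refl
... | true  = refl

OneOrY⇒corner : ∀ {k a b i} → OneOrY {k} (a , b , i) → inY (a , b) ≡ true × i ≡ zero
OneOrY⇒corner is-one = refl , refl
OneOrY⇒corner is-y   = refl , refl

klein-mul : ∀ k (r c : G k) → klein (mul k r c) ≡ klein r ⊞ klein c
klein-mul k (a , b , _) (a' , b' , _) = cong₂ _,_ (addMod2≡⊕ a a') (addMod2≡⊕ b b')

-- The Klein part of the symbol of L* in the cell joining row u of block i to column v of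
-- block i + d + c; the y-correction of L* only occurs for i = 0 (isFirst = true) and c = d = 0.
blockSymbol : (c isFirst d : Bool) → V → V → V
blockSymbol c isFirst d u v = (u ⊞ v) ⊞ yIf ((inY u ∧ isFirst) ∧ (inY v ∧ (not d ∧ not c)))

-- Row u of a block is unused (nothing) or joined to column v of the same block (d = false)
-- or of the next one (d = true).
Pattern : Set
Pattern = V → Maybe (V × Bool)

used : Pattern → ℕ
used P = length (mapMaybe P Vs)

data Position : Set where
  first early late : Position

Positions : List Position
Positions = first ∷ early ∷ late ∷ []

Position-complete : ∀ a → a ∈ Positions
Position-complete first = here refl
Position-complete early = there (here refl)
Position-complete late  = there (there (here refl))

open Enumeration Positions Position-complete renaming (∀? to ∀P?) hiding (∃?)

bothFirst : Position → Position → Bool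
bothFirst first first = true
bothFirst _     _     = false

record BlockOK (c : Bool) (class rowGap symbolHit : V → Bool) (isFirst w₀ w₁ : Bool) (P : Pattern) : Set where
  field
    columns-distinct : ∀ u u' v d → P u ≡ just (v , d) → P u' ≡ just (v , d) → u ≡ u'
    symbols-distinct : ∀ u u' v v' d → P u ≡ just (v , d) → P u' ≡ just (v' , d) →
                       blockSymbol c isFirst d u v ≡ blockSymbol c isFirst d u' v' → u ≡ u'
    symbols-in-class : ∀ u v d → P u ≡ just (v , d) →
                       class (blockSymbol c isFirst d u v) ≡ (if d then w₁ else w₀)
    unused-in-gap    : ∀ u → P u ≡ nothing → rowGap u ≡ true
    symbols-hit      : ∀ s d → symbolHit s ≡ true → class s ≡ (if d then w₁ else w₀) →
                       ∃ λ u → ∃ λ v → P u ≡ just (v , d) × blockSymbol c isFirst d u v ≡ s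

-- P is the pattern of a block and P' that of the next block.
record ConsecutiveOK (colGap : V → Bool) (P P' : Pattern) : Set where
  field
    columns-disjoint : ∀ u u' v → P u ≡ just (v , true) → P' u' ≢ just (v , false)
    columns-covered  : ∀ v → colGap v ≡ false →
                       (∃ λ u → P u ≡ just (v , true)) ⊎ (∃ λ u → P' u ≡ just (v , false))

-- Block 0 follows patternAt first, blocks 1, …, p follow early and the others late; rowGap and
-- colGap bound the Klein parts of unused rows and columns, and the Klein parts in symbolHit must
-- occur among the symbols of every x-coordinate.
record Design : Set where
  field
    shift     : Bool
    patternAt : Position → Bool → Bool → Pattern
    size      : Position → ℕ
    class     : V → Bool
    rowGap colGap symbolHit : V → Bool

-- w₀ is the window bit of slot 0; slot 1 always lies in the window, and the two slots of a
-- later block share their window bit.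
record Valid (D : Design) (w₀ : Bool) : Set where
  open Design D
  field
    first-ok       : BlockOK shift class rowGap symbolHit true w₀ true (patternAt first w₀ true)
    later-ok       : ∀ a w → bothFirst a first ≡ false →
                     BlockOK shift class rowGap symbolHit false w w (patternAt a w w)
    consecutive-ok : ∀ a b → bothFirst a b ≡ false → ∀ w₀ w₁ w₀' w₁' →
                     ConsecutiveOK colGap (patternAt a w₀ w₁) (patternAt b w₀' w₁')
    gaps-hit       : ∀ u v → rowGap u ≡ true → colGap v ≡ true → symbolHit (u ⊞ v) ≡ true
    corner-ok      : ∀ u v → rowGap u ≡ true → colGap v ≡ true → inY u ≡ true → inY v ≡ true →
                     patternAt first w₀ true u ≡ nothing →
                     shift ≡ false × ∃ λ u' → patternAt first w₀ true u' ≡ just (v , false)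
    sizes          : ∀ a w₀ w₁ → used (patternAt a w₀ w₁) ≡ size a

_≟M_ : DecidableEquality (Maybe (V × Bool))
_≟M_ = Maybe.≡-dec (≡-dec _≟V_ Bool._≟_)

blockOK? : ∀ c class rowGap symbolHit isFirst w₀ w₁ P → Dec (BlockOK c class rowGap symbolHit isFirst w₀ w₁ P)
blockOK? c class rowGap symbolHit isFirst w₀ w₁ P =
  map′ (λ (b₁ , b₂ , b₃ , b₄ , b₅) → record { columns-distinct = b₁ ; symbols-distinct = b₂
                                            ; symbols-in-class = b₃ ; unused-in-gap = b₄ ; symbols-hit = b₅ })
       (λ ok → let open BlockOK ok
               in columns-distinct , symbols-distinct , symbols-in-class , unused-in-gap , symbols-hit)
       (columns-distinct? ×-dec symbols-distinct? ×-dec symbols-in-class? ×-dec unused-in-gap? ×-dec symbols-hit?)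
  where
    window : Bool → Bool
    window d = if d then w₁ else w₀
    columns-distinct? = ∀V? λ u → ∀V? λ u' → ∀V? λ v → ∀B? λ d →
      (P u ≟M just (v , d)) →-dec ((P u' ≟M just (v , d)) →-dec (u ≟V u'))
    symbols-distinct? = ∀V? λ u → ∀V? λ u' → ∀V? λ v → ∀V? λ v' → ∀B? λ d →
      (P u ≟M just (v , d)) →-dec ((P u' ≟M just (v' , d)) →-dec
        ((blockSymbol c isFirst d u v ≟V blockSymbol c isFirst d u' v') →-dec (u ≟V u')))
    symbols-in-class? = ∀V? λ u → ∀V? λ v → ∀B? λ d →
      (P u ≟M just (v , d)) →-dec (class (blockSymbol c isFirst d u v) Bool.≟ window d)
    unused-in-gap? = ∀V? λ u → (P u ≟M nothing) →-dec (rowGap u Bool.≟ true)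
    symbols-hit? = ∀V? λ s → ∀B? λ d → (symbolHit s Bool.≟ true) →-dec ((class s Bool.≟ window d) →-dec
      (∃V? λ u → ∃V? λ v → (P u ≟M just (v , d)) ×-dec (blockSymbol c isFirst d u v ≟V s)))

consecutiveOK? : ∀ colGap P P' → Dec (ConsecutiveOK colGap P P')
consecutiveOK? colGap P P' =
  map′ (λ (c₁ , c₂) → record { columns-disjoint = c₁ ; columns-covered = c₂ })
       (λ ok → let open ConsecutiveOK ok in columns-disjoint , columns-covered)
       (columns-disjoint? ×-dec columns-covered?)
  where
    columns-disjoint? = ∀V? λ u → ∀V? λ u' → ∀V? λ v →
      (P u ≟M just (v , true)) →-dec ¬? (P' u' ≟M just (v , false))
    columns-covered? = ∀V? λ v → (colGap v Bool.≟ false) →-dec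
      ((∃V? λ u → P u ≟M just (v , true)) ⊎-dec (∃V? λ u → P' u ≟M just (v , false)))

valid? : ∀ D w₀ → Dec (Valid D w₀)
valid? D w₀ =
  map′ (λ (v₁ , v₂ , v₃ , v₄ , v₅ , v₆) → record { first-ok = v₁ ; later-ok = v₂ ; consecutive-ok = v₃
                                                  ; gaps-hit = v₄ ; corner-ok = v₅ ; sizes = v₆ })
       (λ ok → let open Valid ok in first-ok , later-ok , consecutive-ok , gaps-hit , corner-ok , sizes)
       (first-ok? ×-dec later-ok? ×-dec consecutive-ok? ×-dec gaps-hit? ×-dec corner-ok? ×-dec sizes?)
  where
    open Design D
    block? = blockOK? shift class rowGap symbolHit
    P₀ = patternAt first w₀ true
    first-ok? = block? true w₀ true P₀
    later-ok? = ∀P? λ a → ∀B? λ w → (bothFirst a first Bool.≟ false) →-dec block? false w w (patternAt a w w)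
    consecutive-ok? = ∀P? λ a → ∀P? λ b → (bothFirst a b Bool.≟ false) →-dec
      (∀B? λ w₀ → ∀B? λ w₁ → ∀B? λ w₀' → ∀B? λ w₁' →
        consecutiveOK? colGap (patternAt a w₀ w₁) (patternAt b w₀' w₁'))
    gaps-hit? = ∀V? λ u → ∀V? λ v → (rowGap u Bool.≟ true) →-dec ((colGap v Bool.≟ true) →-dec
      (symbolHit (u ⊞ v) Bool.≟ true))
    corner-ok? = ∀V? λ u → ∀V? λ v → (rowGap u Bool.≟ true) →-dec ((colGap v Bool.≟ true) →-dec
      ((inY u Bool.≟ true) →-dec ((inY v Bool.≟ true) →-dec ((P₀ u ≟M nothing) →-dec
        ((shift Bool.≟ false) ×-dec (∃V? λ u' → P₀ u' ≟M just (v , false)))))))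
    sizes? = ∀P? λ a → ∀B? λ w₀ → ∀B? λ w₁ → used (patternAt a w₀ w₁) ≟ size a

bit : Bool → Fin 2
bit false = zero
bit true  = suc zero

δ : Bool → ℕ
δ d = toℕ (bit d)

δ≤1 : ∀ d → δ d ≤ 1
δ≤1 false = z≤n
δ≤1 true  = s≤s z≤n

bit-injective : ∀ {d d'} → bit d ≡ bit d' → d ≡ d'
bit-injective {false} {false} _ = refl
bit-injective {true}  {true}  _ = refl

module Indices (n : ℕ) (2≤n : 2 ≤ n) (shift : Bool) where

  open Residues n

  -- Row i joined to column block i + d + shift yields symbols of x-coordinate slot i d + shift.
  slot : Fin k → Bool → Fin (k * 2)
  slot i d = combine i (bit d)

  toℕ-slot : ∀ i d → toℕ (slot i d) ≡ toℕ i + toℕ i + δ d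
  toℕ-slot i d = trans (toℕ-combine i (bit d)) (2*x+y≡x+x+y (toℕ i) (δ d))
    where
      2*x+y≡x+x+y : ∀ x m → 2 * x + m ≡ x + x + m
      2*x+y≡x+x+y = solve-∀

  k*2≡k+k : k * 2 ≡ k + k
  k*2≡k+k = lemma n
    where
      lemma : ∀ n → suc n * 2 ≡ suc n + suc n
      lemma = solve-∀

  slot<k+k : ∀ i d → toℕ (slot i d) < k + k
  slot<k+k i d = subst (toℕ (slot i d) <_) k*2≡k+k (toℕ<n (slot i d))

  slot-injective : ∀ {i i' d d'} → slot i d ≡ slot i' d' → i ≡ i' × d ≡ d'
  slot-injective {i} {i'} {d} {d'} eq with combine-injective i (bit d) i' (bit d') eq
  ... | i≡i' , bd≡bd' = i≡i' , bit-injective bd≡bd'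

  slot-surjective : ∀ x → ∃ λ i → ∃ λ d → slot i d ≡ x
  slot-surjective x with combine-surjective {k} {2} x
  ... | i , zero     , eq = i , false , eq
  ... | i , suc zero , eq = i , true  , eq

  column : Fin k → Bool → Fin k
  column i d = [ toℕ i + (δ d + δ shift) ]

  next prev : Fin k → Fin k
  next i = [ toℕ i + 1 ]
  prev i = [ toℕ i + n ]

  symbolIndex : ∀ i d → addMod k i (column i d) ≡ [ toℕ (slot i d) + δ shift ]
  symbolIndex i d = begin
    [ toℕ i + toℕ (column i d) ]               ≡⟨ cong [_] (+-comm (toℕ i) _) ⟩
    [ toℕ (column i d) + toℕ i ]               ≡⟨ []-+ (toℕ i + (δ d + δ shift)) (toℕ i) ⟩
    [ toℕ i + (δ d + δ shift) + toℕ i ]        ≡⟨ cong [_] (rearrange (toℕ i) (δ d) (δ shift)) ⟩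
    [ toℕ i + toℕ i + δ d + δ shift ]          ≡⟨ cong (λ x → [ x + δ shift ]) (≡.sym (toℕ-slot i d)) ⟩
    [ toℕ (slot i d) + δ shift ]               ∎
    where
      open ≡-Reasoning
      rearrange : ∀ x a b → x + (a + b) + x ≡ x + x + a + b
      rearrange = solve-∀

  %≡⇒≡ : ∀ {i i' : Fin k} → toℕ i % k ≡ toℕ i' % k → i ≡ i'
  %≡⇒≡ {i} {i'} eq = toℕ-injective (%-injective (toℕ<n i) (toℕ<n i') eq)

  column-collision : ∀ i d i' d' → column i d ≡ column i' d' →
    (i ≡ i' × d ≡ d') ⊎ (d ≡ true × d' ≡ false × i' ≡ next i) ⊎ (d ≡ false × d' ≡ true × i ≡ next i')
  column-collision i d i' d' eq = by-bits d d' (%-cancelʳ-+ (toℕ i + δ d) (toℕ i' + δ d') (δ shift)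
    (reassoc ([]-injective {toℕ i + (δ d + δ shift)} {toℕ i' + (δ d' + δ shift)} eq)))
    where
      reassoc : ∀ {a b} → (toℕ i + (a + δ shift)) % k ≡ (toℕ i' + (b + δ shift)) % k →
                (toℕ i + a + δ shift) % k ≡ (toℕ i' + b + δ shift) % k
      reassoc {a} {b} =
        ≡.subst₂ (λ a b → a % k ≡ b % k) (≡.sym (+-assoc (toℕ i) a _)) (≡.sym (+-assoc (toℕ i') b _))
      next≡ : ∀ (i i' : Fin k) → (toℕ i + 1) % k ≡ (toℕ i' + 0) % k → i' ≡ next i
      next≡ i i' eq' = trans (≡.sym ([toℕ] i'))
        ([]-cong (toℕ i') (toℕ i + 1) (trans (cong (_% k) (≡.sym (+-identityʳ (toℕ i')))) (≡.sym eq')))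
      by-bits : ∀ d d' → (toℕ i + δ d) % k ≡ (toℕ i' + δ d') % k →
        (i ≡ i' × d ≡ d') ⊎ (d ≡ true × d' ≡ false × i' ≡ next i) ⊎ (d ≡ false × d' ≡ true × i ≡ next i')
      by-bits false false eq' = inj₁ (%≡⇒≡ (%-cancelʳ-+ (toℕ i) (toℕ i') 0 eq') , refl)
      by-bits true  true  eq' = inj₁ (%≡⇒≡ (%-cancelʳ-+ (toℕ i) (toℕ i') 1 eq') , refl)
      by-bits true  false eq' = inj₂ (inj₁ (refl , refl , next≡ i i' eq'))
      by-bits false true  eq' = inj₂ (inj₂ (refl , refl , next≡ i' i (≡.sym eq')))

  owner : Fin k → Fin k
  owner j = [ toℕ j + (k ∸ δ shift) ]

  column-owner : ∀ j → column (owner j) false ≡ j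
  column-owner j = begin
    [ toℕ [ toℕ j + (k ∸ δ shift) ] + δ shift ] ≡⟨ []-+ (toℕ j + (k ∸ δ shift)) (δ shift) ⟩
    [ toℕ j + (k ∸ δ shift) + δ shift ]          ≡⟨ cong [_] (+-assoc (toℕ j) _ (δ shift)) ⟩
    [ toℕ j + (k ∸ δ shift + δ shift) ]
      ≡⟨ cong (λ x → [ toℕ j + x ]) (m∸n+n≡m (≤-trans (δ≤1 shift) (s≤s z≤n))) ⟩
    [ toℕ j + k ]                                ≡⟨ [x+k] (toℕ j) ⟩
    [ toℕ j ]                                    ≡⟨ [toℕ] j ⟩
    j                                            ∎
    where open ≡-Reasoning

  column-prev : ∀ i → column (prev i) true ≡ column i false
  column-prev i = begin
    [ toℕ [ toℕ i + n ] + (1 + δ shift) ] ≡⟨ []-+ (toℕ i + n) (1 + δ shift) ⟩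
    [ toℕ i + n + (1 + δ shift) ]         ≡⟨ cong [_] (rearrange (toℕ i) n (δ shift)) ⟩
    [ toℕ i + δ shift + suc n ]           ≡⟨ [x+k] (toℕ i + δ shift) ⟩
    [ toℕ i + δ shift ]                   ∎
    where
      open ≡-Reasoning
      rearrange : ∀ x n c → x + n + (1 + c) ≡ x + c + suc n
      rearrange = solve-∀

  next-prev : ∀ i → next (prev i) ≡ i
  next-prev i = begin
    [ toℕ [ toℕ i + n ] + 1 ] ≡⟨ []-+ (toℕ i + n) 1 ⟩
    [ toℕ i + n + 1 ]         ≡⟨ cong [_] (trans (+-assoc (toℕ i) n 1) (cong (toℕ i +_) (+-comm n 1))) ⟩
    [ toℕ i + k ]             ≡⟨ [x+k] (toℕ i) ⟩
    [ toℕ i ]                 ≡⟨ [toℕ] i ⟩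
    i                         ∎
    where open ≡-Reasoning

  next-zero : next zero ≢ zero
  next-zero eq with trans (≡.sym (m<n⇒m%n≡m (s≤s (≤-trans (s≤s z≤n) 2≤n))))
                         (trans (≡.sym (toℕ-[] 1)) (cong toℕ eq))
  ... | ()

  isZero-column-zero : ∀ d → isZero (column zero d) ≡ not d ∧ not shift
  isZero-column-zero d = trans (cong isZero ([]≡fromℕ< (bound d shift))) (by-bits d shift)
    where
      bound : ∀ d c → δ d + δ c < k
      bound d c = s≤s (≤-trans (+-mono-≤ (δ≤1 d) (δ≤1 c)) 2≤n)
      by-bits : ∀ d c → isZero (fromℕ< (bound d c)) ≡ not d ∧ not c
      by-bits false false = refl
      by-bits false true  = refl
      by-bits true  false = refl
      by-bits true  true  = refl

module Blocks (n q : ℕ) (q≤1 : q ≤ 1) (h : ℕ) (k+q≡h+h : suc n + q ≡ h + h) (2≤n : 2 ≤ n)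
              (D : Design) (valid : Valid D ⌊ q ≤? 0 ⌋) (p : ℕ) (p≤n : p ≤ n) where

  open Residues n
  open Window q q≤1
  open Design D
  open Valid valid
  open Indices n 2≤n shift

  windowBit : Fin k → Bool → Bool
  windowBit i d = inWindow (toℕ (slot i d))

  slot-collision : ∀ i d i' d' → [ toℕ (slot i d) + δ shift ] ≡ [ toℕ (slot i' d') + δ shift ] →
                   windowBit i d ≡ windowBit i' d' → i ≡ i' × d ≡ d'
  slot-collision i d i' d' eq w = slot-injective (toℕ-injective
    (inWindow-unique x x' (slot<k+k i d) (slot<k+k i' d')
      (%-cancelʳ-+ x x' (δ shift) ([]-injective {x + δ shift} {x' + δ shift} eq)) w))
    where
      x  = toℕ (slot i d)
      x' = toℕ (slot i' d')

  slot-hit : ∀ j w → ∃ λ i → ∃ λ d → [ toℕ (slot i d) + δ shift ] ≡ j × windowBit i d ≡ w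
  slot-hit j w with inWindow-hit (toℕ (owner j)) w
  ... | x , x<k+k , x≡owner , in-w with slot-surjective (fromℕ< (subst (x <_) (≡.sym k*2≡k+k) x<k+k))
  ...   | i , d , eq = i , d , hits , trans (cong inWindow slot≡x) in-w
    where
      slot≡x : toℕ (slot i d) ≡ x
      slot≡x = trans (cong toℕ eq) (toℕ-fromℕ< _)
      hits : [ toℕ (slot i d) + δ shift ] ≡ j
      hits = begin
        [ toℕ (slot i d) + δ shift ]    ≡⟨ cong (λ x → [ x + δ shift ]) slot≡x ⟩
        [ x + δ shift ]
          ≡⟨ []-cong (x + δ shift) (toℕ (owner j) + δ shift) (%-congʳ-+ x (toℕ (owner j)) (δ shift) x≡owner) ⟩
        [ toℕ (owner j) + δ shift ]     ≡⟨ column-owner j ⟩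
        j                               ∎
        where open ≡-Reasoning

  windowBit-bit : ∀ i d → (if d then windowBit i true else windowBit i false) ≡ windowBit i d
  windowBit-bit i false = refl
  windowBit-bit i true  = refl

  windowBit-later : ∀ i → windowBit (suc i) true ≡ windowBit (suc i) false
  windowBit-later i = begin
    inWindow (toℕ (slot (suc i) true))  ≡⟨ cong inWindow (toℕ-slot (suc i) true) ⟩
    inWindow (x + x + 1)                ≡⟨ ≡.sym (inWindow-pair h k+q≡h+h x (s≤s z≤n)) ⟩
    inWindow (x + x)
      ≡⟨ cong inWindow (≡.sym (trans (toℕ-slot (suc i) false) (+-identityʳ (x + x)))) ⟩
    inWindow (toℕ (slot (suc i) false)) ∎
    where
      open ≡-Reasoning
      x = suc (toℕ i)

  position : Fin k → Position
  position zero    = first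
  position (suc i) = if ⌊ suc (toℕ i) ≤? p ⌋ then early else late

  blockPattern : Fin k → Pattern
  blockPattern i = patternAt (position i) (windowBit i false) (windowBit i true)

  later-not-first : ∀ i b → bothFirst (position (suc i)) b ≡ false
  later-not-first i b with ⌊ suc (toℕ i) ≤? p ⌋
  ... | true  = refl
  ... | false = refl

  BlockOK-at : Fin k → Set
  BlockOK-at i =
    BlockOK shift class rowGap symbolHit (isZero i) (windowBit i false) (windowBit i true) (blockPattern i)

  block-ok : ∀ i → BlockOK-at i
  block-ok zero    =
    ≡.subst₂ (λ w₀ w₁ → BlockOK shift class rowGap symbolHit true w₀ w₁ (patternAt first w₀ w₁))
      (≡.sym inWindow-0) (≡.sym (inWindow-1 (≤-trans (s≤s z≤n) 2≤n))) first-ok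
  block-ok (suc i) =
    subst (λ w₁ → BlockOK shift class rowGap symbolHit false w w₁ (patternAt (position (suc i)) w w₁))
      (≡.sym (windowBit-later i)) (later-ok (position (suc i)) w (later-not-first i first))
    where w = windowBit (suc i) false

  consecutive : ∀ i → ConsecutiveOK colGap (blockPattern i) (blockPattern (next i))
  consecutive i =
    consecutive-ok (position i) (position (next i)) (not-both-first i (next i) (λ { refl → next-zero })) _ _ _ _
    where
      not-both-first : ∀ i j → (i ≡ zero → j ≢ zero) → bothFirst (position i) (position j) ≡ false
      not-both-first zero    zero    j≢0 = ⊥-elim (j≢0 refl refl)
      not-both-first zero    (suc j) _   with ⌊ suc (toℕ j) ≤? p ⌋
      ... | true  = refl
      ... | false = refl
      not-both-first (suc i) j       _   = later-not-first i (position j)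

  at : Fin k → V → G k
  at i (a , b) = a , b , i

  at-injective : ∀ {i i' u u'} → at i u ≡ at i' u' → i ≡ i' × u ≡ u'
  at-injective {u = _ , _} {u' = _ , _} refl = refl , refl

  G-≡ : ∀ {g g' : G k} → klein g ≡ klein g' → xPart g ≡ xPart g' → g ≡ g'
  G-≡ {_ , _ , _} {_ , _ , _} refl refl = refl

  cell : Fin k → V → V × Bool → Triple (G k)
  cell i u (v , d) = at i u , at (column i d) v , symbol k (at i u) (at (column i d) v)

  klein-cell : ∀ i u v d → klein (sym (cell i u (v , d))) ≡ blockSymbol shift (isZero i) d u v
  klein-cell i u@(a , b) v@(a' , b') d =
    trans (klein-symbol k (at i u) (at (column i d) v)) (cong (λ f → (u ⊞ v) ⊞ yIf f) (corner i))
    where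
      corner : ∀ i → (isZero b ∧ isZero i) ∧ (isZero b' ∧ isZero (column i d))
                   ≡ (isZero b ∧ isZero i) ∧ (isZero b' ∧ (not d ∧ not shift))
      corner zero    = cong (λ x → (isZero b ∧ true) ∧ (isZero b' ∧ x)) (isZero-column-zero d)
      corner (suc i) rewrite Bool.∧-zeroʳ (isZero b) = refl

  xPart-cell : ∀ i u v d → xPart (sym (cell i u (v , d))) ≡ [ toℕ (slot i d) + δ shift ]
  xPart-cell i u v d = trans (xPart-symbol k (at i u) (at (column i d) v))
    (trans (cong₂ (addMod k) (xPart-at i u) (xPart-at (column i d) v)) (symbolIndex i d))
    where
      xPart-at : ∀ i u → xPart (at i u) ≡ i
      xPart-at i (_ , _) = refl

  rowTriple : G k → Maybe (Triple (G k))
  rowTriple (a , b , i) = Maybe.map (cell i (a , b)) (blockPattern i (a , b))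

  rowTriple-row : ∀ {r t} → rowTriple r ≡ just t → row t ≡ r
  rowTriple-row {a , b , i} eq with blockPattern i (a , b) | eq
  ... | just _ | refl = refl

  rows : List (G k)
  rows = cartesianProductWith at (allFin k) Vs

  T : List (Triple (G k))
  T = mapMaybe rowTriple rows

  IsCell : Triple (G k) → Set
  IsCell t = ∃ λ i → ∃ λ u → ∃ λ v → ∃ λ d → blockPattern i u ≡ just (v , d) × t ≡ cell i u (v , d)

  ∈T⁻ : ∀ {t} → t ∈ T → IsCell t
  ∈T⁻ t∈T with ∈-mapMaybe⁻ rowTriple rows t∈T
  ... | (a , b , i) , _ , eq with blockPattern i (a , b) in pat | eq
  ...   | just (v , d) | refl = i , (a , b) , v , d , pat , refl

  ∈T⁺ : ∀ {i u v d} → blockPattern i u ≡ just (v , d) → cell i u (v , d) ∈ T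
  ∈T⁺ {i} {u} eq = ∈-mapMaybe⁺ rowTriple
    (∈-cartesianProductWith⁺ at (∈-allFin i) (V-complete u)) (cong (Maybe.map (cell i u)) eq)

  ∈T⇒rowTriple : ∀ {t} → t ∈ T → rowTriple (row t) ≡ just t
  ∈T⇒rowTriple t∈T with ∈-mapMaybe⁻ rowTriple rows t∈T
  ... | r , _ , eq = subst (λ r → rowTriple r ≡ just _) (≡.sym (rowTriple-row eq)) eq

  T-unique : Unique T
  T-unique = Unique-mapMaybe rowTriple (λ eq eq' → trans (≡.sym (rowTriple-row eq)) (rowTriple-row eq'))
               (cartesianProductWith⁺ at at-injective (allFin⁺ k) Vs-unique)

  T-rows : ∀ {t t'} → t ∈ T → t' ∈ T → row t ≡ row t' → t ≡ t'
  T-rows {t} {t'} t∈T t'∈T eq = Maybe.just-injective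
    (trans (≡.sym (∈T⇒rowTriple t∈T)) (trans (cong rowTriple eq) (∈T⇒rowTriple t'∈T)))

  T-cols : ∀ {t t'} → t ∈ T → t' ∈ T → col t ≡ col t' → t ≡ t'
  T-cols t∈T t'∈T eq with ∈T⁻ t∈T | ∈T⁻ t'∈T
  ... | i , u , v , d , pat , refl | i' , u' , v' , d' , pat' , refl
    with at-injective eq
  ...   | col≡ , refl with column-collision i d i' d' col≡
  ...     | inj₁ (refl , refl) = T-rows t∈T t'∈T
              (cong (at i) (BlockOK.columns-distinct (block-ok i) u u' v d pat pat'))
  ...     | inj₂ (inj₁ (refl , refl , refl)) = ⊥-elim (ConsecutiveOK.columns-disjoint (consecutive i) u u' v pat pat')
  ...     | inj₂ (inj₂ (refl , refl , refl)) = ⊥-elim (ConsecutiveOK.columns-disjoint (consecutive i') u' u v pat' pat)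

  same-symbol : ∀ {i u v d i' u' v' d'} → blockPattern i u ≡ just (v , d) → blockPattern i' u' ≡ just (v' , d') →
    blockSymbol shift (isZero i) d u v ≡ blockSymbol shift (isZero i') d' u' v' →
    [ toℕ (slot i d) + δ shift ] ≡ [ toℕ (slot i' d') + δ shift ] → at i u ≡ at i' u'
  same-symbol {i} {u} {v} {d} {i'} {u'} {v'} {d'} pat pat' same-klein same-x
    with slot-collision i d i' d' same-x (trans (≡.sym (window pat)) (trans (cong class same-klein) (window pat')))
    where
      window : ∀ {i u v d} → blockPattern i u ≡ just (v , d) →
               class (blockSymbol shift (isZero i) d u v) ≡ windowBit i d
      window {i} {u} {v} {d} pat = trans (BlockOK.symbols-in-class (block-ok i) u v d pat) (windowBit-bit i d)
  ... | refl , refl = cong (at i) (BlockOK.symbols-distinct (block-ok i) u u' v v' d pat pat' same-klein)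

  T-syms : ∀ {t t'} → t ∈ T → t' ∈ T → sym t ≡ sym t' → t ≡ t'
  T-syms t∈T t'∈T eq with ∈T⁻ t∈T | ∈T⁻ t'∈T
  ... | i , u , v , d , pat , refl | i' , u' , v' , d' , pat' , refl = T-rows t∈T t'∈T (same-symbol pat pat'
          (trans (≡.sym (klein-cell i u v d)) (trans (cong klein eq) (klein-cell i' u' v' d')))
          (trans (≡.sym (xPart-cell i u v d)) (trans (cong xPart eq) (xPart-cell i' u' v' d'))))

  T-partial : IsPartialTransversal (LStar k) T
  T-partial = record
    { inL      = λ t∈T → inL (∈T⁻ t∈T)
    ; rowsUniq = T-rows
    ; colsUniq = T-cols
    ; symsUniq = T-syms
    ; noDup    = T-unique }
    where
      inL : ∀ {t} → IsCell t → LStar k t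
      inL (i , u , v , d , _ , refl) = symbol∈LStar n (at i u) (at (column i d) v)

  column-used : ∀ j v → colGap v ≡ false → ∃ λ t → t ∈ T × col t ≡ at j v
  column-used j v gap = by-neighbour (ConsecutiveOK.columns-covered (consecutive (prev (owner j))) v gap)
    where
      o = owner j
      by-neighbour : (∃ λ u → blockPattern (prev o) u ≡ just (v , true))
                   ⊎ (∃ λ u → blockPattern (next (prev o)) u ≡ just (v , false)) →
                     ∃ λ t → t ∈ T × col t ≡ at j v
      by-neighbour (inj₁ (u , pat)) = cell (prev o) u (v , true) , ∈T⁺ pat ,
                                      cong (λ c → at c v) (trans (column-prev o) (column-owner j))
      by-neighbour (inj₂ (u , pat)) =
        cell o u (v , false) , ∈T⁺ (subst (λ i → blockPattern i u ≡ just (v , false)) (next-prev o) pat) ,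
        cong (λ c → at c v) (column-owner j)

  symbol-used : ∀ g → symbolHit (klein g) ≡ true → ∃ λ t → t ∈ T × sym t ≡ g
  symbol-used g hit = in-slot (slot-hit (xPart g) (class (klein g)))
    where
      in-slot : (∃ λ i → ∃ λ d → [ toℕ (slot i d) + δ shift ] ≡ xPart g × windowBit i d ≡ class (klein g)) →
                ∃ λ t → t ∈ T × sym t ≡ g
      in-slot (i , d , x≡ , w≡) =
        in-block (BlockOK.symbols-hit (block-ok i) (klein g) d hit (≡.sym (trans (windowBit-bit i d) w≡)))
        where
          in-block : (∃ λ u → ∃ λ v → blockPattern i u ≡ just (v , d) × blockSymbol shift (isZero i) d u v ≡ klein g) →
                     ∃ λ t → t ∈ T × sym t ≡ g
          in-block (u , v , pat , s≡) =
            cell i u (v , d) , ∈T⁺ pat , G-≡ (trans (klein-cell i u v d) s≡) (trans (xPart-cell i u v d) x≡)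

  first-pattern : blockPattern zero ≡ patternAt first ⌊ q ≤? 0 ⌋ true
  first-pattern = cong₂ (patternAt first) inWindow-0 (inWindow-1 (≤-trans (s≤s z≤n) 2≤n))

  -- The cells of L* whose symbol was changed are blocked through their column.
  corner-used : ∀ u v → rowGap u ≡ true → colGap v ≡ true → inY u ≡ true → inY v ≡ true →
                blockPattern zero u ≡ nothing → ∃ λ t → t ∈ T × col t ≡ at zero v
  corner-used u v row-gap col-gap u∈Y v∈Y unused =
    used-column (corner-ok u v row-gap col-gap u∈Y v∈Y (subst (λ P → P u ≡ nothing) first-pattern unused))
    where
      used-column : shift ≡ false × (∃ λ u' → patternAt first ⌊ q ≤? 0 ⌋ true u' ≡ just (v , false)) →
                    ∃ λ t → t ∈ T × col t ≡ at zero v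
      used-column (no-shift , u' , pat) =
        cell zero u' (v , false) , ∈T⁺ (subst (λ P → P u' ≡ just (v , false)) (≡.sym first-pattern) pat) ,
        cong (λ c → at [ δ c ] v) no-shift

  sharing-column : ∀ {r c s} → (∃ λ t → t ∈ T × col t ≡ c) → Any (SharesLine r c s) T
  sharing-column (t , t∈T , eq) = lose t∈T (inj₂ (inj₁ eq))

  sharing-symbol : ∀ {r c s} → (∃ λ t → t ∈ T × sym t ≡ s) → Any (SharesLine r c s) T
  sharing-symbol (t , t∈T , eq) = lose t∈T (inj₂ (inj₂ eq))

  unused-row-blocked : ∀ a b i c → blockPattern i (a , b) ≡ nothing →
                       Any (SharesLine (a , b , i) c (symbol k (a , b , i) c)) T
  unused-row-blocked a b i c@(a' , b' , j) unused = by-column (colGap (a' , b')) refl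
    where
      row-gap : rowGap (a , b) ≡ true
      row-gap = BlockOK.unused-in-gap (block-ok i) (a , b) unused

      corner : OneOrY (a , b , i) → OneOrY c → colGap (a' , b') ≡ true →
               Any (SharesLine (a , b , i) c (symbol k (a , b , i) c)) T
      corner r-on c-on col-gap with OneOrY⇒corner r-on | OneOrY⇒corner c-on
      ... | u∈Y , refl | v∈Y , refl = sharing-column (corner-used (a , b) (a' , b') row-gap col-gap u∈Y v∈Y unused)

      off-corner : oneOrY (a , b , i) ≡ false ⊎ oneOrY c ≡ false → colGap (a' , b') ≡ true →
                   Any (SharesLine (a , b , i) c (symbol k (a , b , i) c)) T
      off-corner off col-gap = sharing-symbol (symbol-used (symbol k (a , b , i) c) (subst (λ s → symbolHit s ≡ true)
        (≡.sym (trans (cong klein (symbol-off-corner k (a , b , i) c off)) (klein-mul k (a , b , i) c)))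
        (gaps-hit (a , b) (a' , b') row-gap col-gap)))

      by-column : ∀ g → colGap (a' , b') ≡ g → Any (SharesLine (a , b , i) c (symbol k (a , b , i) c)) T
      by-column false col-used = sharing-column (column-used j (a' , b') col-used)
      by-column true  col-gap  with oneOrY? (a , b , i) | oneOrY? c
      ... | inj₁ r-on  | inj₁ c-on  = corner r-on c-on col-gap
      ... | inj₂ r-off | _          = off-corner (inj₁ r-off) col-gap
      ... | inj₁ _     | inj₂ c-off = off-corner (inj₂ c-off) col-gap

  T-blocking : ∀ r c → Any (SharesLine r c (symbol k r c)) T
  T-blocking (a , b , i) c = by-row (blockPattern i (a , b)) refl
    where
      by-row : ∀ m → blockPattern i (a , b) ≡ m → Any (SharesLine (a , b , i) c (symbol k (a , b , i) c)) T
      by-row (just (v , d)) pat    = lose (∈T⁺ pat) (inj₁ refl)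
      by-row nothing        unused = unused-row-blocked a b i c unused

  T-maximal : MaximalPT (LStar k) T
  T-maximal = maximal-if-blocking (symbol k) (LStar⇒symbol n) T-partial T-blocking

  length-rows : ∀ m (f : Fin m → Fin k) → length (mapMaybe rowTriple (cartesianProductWith at (tabulate f) Vs))
                                          ≡ sum (tabulate (λ j → used (blockPattern (f j))))
  length-rows zero    f = refl
  length-rows (suc m) f = begin
    length (mapMaybe rowTriple (block ++ rest))                  ≡⟨ cong length (mapMaybe-++ rowTriple block rest) ⟩
    length (mapMaybe rowTriple block ++ mapMaybe rowTriple rest) ≡⟨ length-++ (mapMaybe rowTriple block) ⟩
    length (mapMaybe rowTriple block) + length (mapMaybe rowTriple rest)
      ≡⟨ cong₂ _+_ (length-mapMaybe-map (blockPattern (f zero)) (cell (f zero)) Vs) (length-rows m (f ∘ suc)) ⟩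
    used (blockPattern (f zero)) + sum (tabulate (λ j → used (blockPattern (f (suc j))))) ∎
    where
      open ≡-Reasoning
      block = map (at (f zero)) Vs
      rest = cartesianProductWith at (tabulate (f ∘ suc)) Vs

  laterSize : ℕ → ℕ
  laterSize x = if ⌊ x ≤? p ⌋ then size early else size late

  sizesFrom : ℕ → ℕ → ℕ
  sizesFrom o zero    = 0
  sizesFrom o (suc m) = laterSize o + sizesFrom (suc o) m

  sum-laterSizes : ∀ m o (h : Fin m → ℕ) → (∀ j → h j ≡ laterSize (o + toℕ j)) →
                   sum (tabulate h) ≡ sizesFrom o m
  sum-laterSizes zero    o h _  = refl
  sum-laterSizes (suc m) o h h≡ = cong₂ _+_ (trans (h≡ zero) (cong laterSize (+-identityʳ o)))
    (sum-laterSizes m (suc o) (h ∘ suc) (λ j → trans (h≡ (suc j)) (cong laterSize (+-suc o (toℕ j)))))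

  sizesFrom-+ : ∀ o m m' → sizesFrom o (m + m') ≡ sizesFrom o m + sizesFrom (o + m) m'
  sizesFrom-+ o zero    m' = cong (λ x → sizesFrom x m') (≡.sym (+-identityʳ o))
  sizesFrom-+ o (suc m) m' = begin
    laterSize o + sizesFrom (suc o) (m + m')
      ≡⟨ cong (laterSize o +_) (sizesFrom-+ (suc o) m m') ⟩
    laterSize o + (sizesFrom (suc o) m + sizesFrom (suc o + m) m')
      ≡⟨ cong (λ x → laterSize o + (sizesFrom (suc o) m + sizesFrom x m')) (≡.sym (+-suc o m)) ⟩
    laterSize o + (sizesFrom (suc o) m + sizesFrom (o + suc m) m')
      ≡⟨ ≡.sym (+-assoc (laterSize o) _ _) ⟩
    laterSize o + sizesFrom (suc o) m + sizesFrom (o + suc m) m' ∎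
    where open ≡-Reasoning

  sizesFrom-early : ∀ o m → o + m ≤ suc p → sizesFrom o m ≡ size early * m
  sizesFrom-early o zero    _ = ≡.sym (*-zeroʳ (size early))
  sizesFrom-early o (suc m) le with o ≤? p
  ... | yes _ = trans (cong (size early +_) (sizesFrom-early (suc o) m (subst (_≤ suc p) (+-suc o m) le)))
                      (≡.sym (*-suc (size early) m))
  ... | no o≰p = ⊥-elim (o≰p (≤-pred (≤-trans (s≤s (m≤m+n o m)) (subst (_≤ suc p) (+-suc o m) le))))

  sizesFrom-late : ∀ o m → p < o → sizesFrom o m ≡ size late * m
  sizesFrom-late o zero    _ = ≡.sym (*-zeroʳ (size late))
  sizesFrom-late o (suc m) lt with o ≤? p
  ... | yes o≤p = ⊥-elim (<⇒≱ lt o≤p)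
  ... | no _    = trans (cong (size late +_) (sizesFrom-late (suc o) m (≤-trans lt (n≤1+n o))))
                        (≡.sym (*-suc (size late) m))

  length-T : length T ≡ size first + (size early * p + size late * (n ∸ p))
  length-T = begin
    length T
      ≡⟨ length-rows k id ⟩
    used (blockPattern zero) + sum (tabulate (λ j → used (blockPattern (suc j))))
      ≡⟨ cong₂ _+_ (sizes first _ _) (sum-laterSizes n 1 _ later-size) ⟩
    size first + sizesFrom 1 n
      ≡⟨ cong (λ m → size first + sizesFrom 1 m) (≡.sym (m+[n∸m]≡n p≤n)) ⟩
    size first + sizesFrom 1 (p + (n ∸ p))
      ≡⟨ cong (size first +_) (sizesFrom-+ 1 p (n ∸ p)) ⟩
    size first + (sizesFrom 1 p + sizesFrom (suc p) (n ∸ p))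
      ≡⟨ cong (size first +_) (cong₂ _+_ (sizesFrom-early 1 p ≤-refl) (sizesFrom-late (suc p) (n ∸ p) ≤-refl)) ⟩
    size first + (size early * p + size late * (n ∸ p)) ∎
    where
      open ≡-Reasoning
      later-size : ∀ j → used (blockPattern (suc j)) ≡ laterSize (suc (toℕ j))
      later-size j = trans (sizes (position (suc j)) _ _) (Bool.if-float size ⌊ suc (toℕ j) ≤? p ⌋)

design-transversal : ∀ {n q h} → q ≤ 1 → suc n + q ≡ h + h → 2 ≤ n →
  (D : Design) → Valid D ⌊ q ≤? 0 ⌋ → ∀ {p} → p ≤ n → let open Design D in
  ∃ λ T → MaximalPT (LStar (suc n)) T × length T ≡ size first + (size early * p + size late * (n ∸ p))
design-transversal {n} {q} {h} q≤1 even 2≤n D valid {p} p≤n = T , T-maximal , length-T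
  where open Blocks n q q≤1 h even 2≤n D valid p p≤n

inZ : V → Bool
inZ (a , _) = isZero a

classK classN : V → Bool
classK (a , b) = not (isZero (a ⊕ b))
classN (a , b) = isZero (a ⊕ b)

fullK collapsedK fullN collapsedN : Bool → Bool → Pattern
fullK w₀ w₁ e  = just ((if w₀ then z else e) , false)
fullK w₀ w₁ y  = just ((if w₀ then e else z) , false)
fullK w₀ w₁ z  = just ((if w₁ then yz else y) , true)
fullK w₀ w₁ yz = just ((if w₁ then y else yz) , true)

collapsedK false _ e  = just (e , false)
collapsedK false _ y  = just (y , true)
collapsedK true  _ y  = just (e , false)
collapsedK true  _ e  = just (y , true)
collapsedK _     _ z  = nothing
collapsedK _     _ yz = nothing

fullN w₀ w₁ y  = just ((if w₀ then y else e) , false)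
fullN w₀ w₁ yz = just ((if w₀ then e else y) , false)
fullN w₀ w₁ e  = just ((if w₁ then yz else z) , true)
fullN w₀ w₁ z  = just ((if w₁ then z else yz) , true)

collapsedN false _ yz = just (y , false)
collapsedN false _ y  = just (yz , true)
collapsedN true  _ y  = just (y , false)
collapsedN true  _ yz = just (yz , true)
collapsedN _     _ e  = nothing
collapsedN _     _ z  = nothing

firstOdd firstMinimal : Bool → Bool → Pattern
firstOdd _  _ e  = nothing
firstOdd w₀ _ z  = just ((if w₀ then y else e) , false)
firstOdd w₀ _ y  = just ((if w₀ then e else y) , false)
firstOdd w₀ _ yz = just (yz , true)

firstMinimal _ _ e  = just (y , true)
firstMinimal _ _ y  = just (e , false)
firstMinimal _ _ z  = nothing
firstMinimal _ _ yz = nothing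

outsideY : V → Bool
outsideY u = not (inY u)

evenDesign : Design
evenDesign = record
  { shift = true
  ; patternAt = λ { first → fullK ; early → collapsedK ; late → fullK }
  ; size = λ { first → 4 ; early → 2 ; late → 4 }
  ; class = classK ; rowGap = outsideY ; colGap = outsideY ; symbolHit = inY }

evenDesign-valid : ∀ w₀ → Valid evenDesign w₀
evenDesign-valid true  = toWitness {a? = valid? evenDesign true} tt
evenDesign-valid false = toWitness {a? = valid? evenDesign false} tt

oddDesign : Design
oddDesign = record
  { shift = false
  ; patternAt = λ { first → firstOdd ; early → collapsedN ; late → fullN }
  ; size = λ { first → 3 ; early → 2 ; late → 4 }
  ; class = classN ; rowGap = inZ ; colGap = inZ ; symbolHit = inZ }

oddDesign-valid : ∀ w₀ → Valid oddDesign w₀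
oddDesign-valid true  = toWitness {a? = valid? oddDesign true} tt
oddDesign-valid false = toWitness {a? = valid? oddDesign false} tt

minimalDesign : Bool → Design
minimalDesign w₀ = record
  { shift = w₀
  ; patternAt = λ { first → if w₀ then collapsedK else firstMinimal ; early → collapsedK ; late → collapsedK }
  ; size = λ _ → 2
  ; class = classK ; rowGap = outsideY ; colGap = outsideY ; symbolHit = inY }

minimalDesign-valid : ∀ w₀ → Valid (minimalDesign w₀) w₀
minimalDesign-valid true  = toWitness {a? = valid? (minimalDesign true) true} tt
minimalDesign-valid false = toWitness {a? = valid? (minimalDesign false) false} tt

infix 5 _x^_
_x^_ : V → Fin 2 → G 2
(a , b) x^ i = a , b , i

elementsG : ∀ k → List (G k)
elementsG k = cartesianProduct (allFin 2) (cartesianProduct (allFin 2) (allFin k))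

elementsG-complete : ∀ {k} (g : G k) → g ∈ elementsG k
elementsG-complete (a , b , i) =
  ∈-cartesianProduct⁺ (∈-allFin a) (∈-cartesianProduct⁺ (∈-allFin b) (∈-allFin i))

open Certificates (symbol 2) (LStar⇒symbol 1)
  (≡-dec Fin._≟_ (≡-dec Fin._≟_ Fin._≟_)) (elementsG 2) elementsG-complete (symbol∈LStar 1)

-- Maximal partial transversals of L* for k = 2, found by computer search.
transversal₄ : List (Triple (G 2))
transversal₄ =
  (z x^ 0F , z x^ 1F , e x^ 1F)
  ∷ (yz x^ 0F , e x^ 1F , yz x^ 1F)
  ∷ (e x^ 0F , y x^ 1F , y x^ 1F)
  ∷ (y x^ 0F , yz x^ 1F , z x^ 1F)
  ∷ []
transversal₅ : List (Triple (G 2))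
transversal₅ =
  (z x^ 0F , y x^ 1F , yz x^ 1F)
  ∷ (yz x^ 1F , yz x^ 0F , e x^ 1F)
  ∷ (y x^ 0F , e x^ 0F , e x^ 0F)
  ∷ (e x^ 1F , z x^ 1F , z x^ 0F)
  ∷ (yz x^ 0F , z x^ 0F , y x^ 0F)
  ∷ []
transversal₆ : List (Triple (G 2))
transversal₆ =
  (z x^ 1F , e x^ 0F , z x^ 1F)
  ∷ (yz x^ 1F , z x^ 0F , y x^ 1F)
  ∷ (yz x^ 0F , yz x^ 1F , e x^ 1F)
  ∷ (z x^ 0F , y x^ 0F , yz x^ 0F)
  ∷ (e x^ 1F , y x^ 1F , y x^ 0F)
  ∷ (y x^ 0F , z x^ 1F , yz x^ 1F)
  ∷ []
transversal₇ : List (Triple (G 2))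
transversal₇ =
  (z x^ 1F , yz x^ 0F , y x^ 1F)
  ∷ (e x^ 1F , e x^ 1F , e x^ 0F)
  ∷ (y x^ 1F , z x^ 1F , yz x^ 0F)
  ∷ (yz x^ 0F , yz x^ 1F , e x^ 1F)
  ∷ (yz x^ 1F , e x^ 0F , yz x^ 1F)
  ∷ (y x^ 0F , y x^ 0F , y x^ 0F)
  ∷ (e x^ 0F , z x^ 0F , z x^ 0F)
  ∷ []
transversal₈ : List (Triple (G 2))
transversal₈ =
  (yz x^ 0F , e x^ 1F , yz x^ 1F)
  ∷ (y x^ 0F , z x^ 0F , yz x^ 0F)
  ∷ (e x^ 0F , y x^ 1F , y x^ 1F)
  ∷ (yz x^ 1F , yz x^ 1F , e x^ 0F)
  ∷ (y x^ 1F , y x^ 0F , e x^ 1F)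
  ∷ (z x^ 0F , yz x^ 0F , y x^ 0F)
  ∷ (e x^ 1F , z x^ 1F , z x^ 0F)
  ∷ (z x^ 1F , e x^ 0F , z x^ 1F)
  ∷ []

omniversal₂ : Omniversal 8 (LStar 2)
omniversal₂ 4 _ _ = transversal₄ , certificate⇒maximal (toWitness {a? = certificate? transversal₄} tt) , refl
omniversal₂ 5 _ _ = transversal₅ , certificate⇒maximal (toWitness {a? = certificate? transversal₅} tt) , refl
omniversal₂ 6 _ _ = transversal₆ , certificate⇒maximal (toWitness {a? = certificate? transversal₆} tt) , refl
omniversal₂ 7 _ _ = transversal₇ , certificate⇒maximal (toWitness {a? = certificate? transversal₇} tt) , refl
omniversal₂ 8 _ _ = transversal₈ , certificate⇒maximal (toWitness {a? = certificate? transversal₈} tt) , refl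
omniversal₂ 0 () _
omniversal₂ 1 (s≤s ()) _
omniversal₂ 2 (s≤s (s≤s ())) _
omniversal₂ 3 (s≤s (s≤s (s≤s ()))) _
omniversal₂ (suc (suc (suc (suc (suc (suc (suc (suc (suc _))))))))) _
            (s≤s (s≤s (s≤s (s≤s (s≤s (s≤s (s≤s (s≤s ()))))))))

data Halves : ℕ → Set where
  twice   : ∀ p → Halves (p + p)
  twice+1 : ∀ p → Halves (suc (p + p))

halves : ∀ d → Halves d
halves zero    = twice 0
halves (suc d) with halves d
... | twice p   = twice+1 p
... | twice+1 p = subst Halves (cong suc (+-suc p p)) (twice (suc p))

m+m<n+n⇒m<n : ∀ {m n} → m + m < n + n → m < n
m+m<n+n⇒m<n {m} {n} m+m<n+n with m <? n
... | yes m<n = m<n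
... | no m≮n  = ⊥-elim (<⇒≱ m+m<n+n (+-mono-≤ (≮⇒≥ m≮n) (≮⇒≥ m≮n)))

module _ {n q h : ℕ} (q≤1 : q ≤ 1) (even : suc n + q ≡ h + h) (2≤n : 2 ≤ n) where

  Realised : ℕ → Set
  Realised ℓ = ∃ λ T → MaximalPT (LStar (suc n)) T × length T ≡ ℓ

  realise : (D : Design) → Valid D ⌊ q ≤? 0 ⌋ → ∀ p r → p + r ≡ n → ∀ {ℓ} →
            Design.size D first + (Design.size D early * p + Design.size D late * r) ≡ ℓ → Realised ℓ
  realise D valid p r refl {ℓ} len with design-transversal {h = h} q≤1 even 2≤n D valid (m≤m+n p r)
  ... | T , maximal , length-T = T , maximal ,
        trans length-T (trans (cong (λ x → size first + (size early * p + size late * x)) (m+n∸m≡n p r)) len)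
    where open Design D

  -- The defect 4k - ℓ is 2p with p ≤ n (evenDesign), 2k (minimalDesign) or 2p + 1 (oddDesign).
  omniversal-k≥3 : Omniversal (4 * suc n) (LStar (suc n))
  omniversal-k≥3 ℓ lo hi = by-defect (halves (4 * suc n ∸ ℓ)) (m+[n∸m]≡n hi)
    where
      four : ∀ n → 4 * suc n ≡ (suc n + suc n) + (suc n + suc n)
      four = solve-∀

      defect< : ∀ {d} → ℓ + d ≡ 4 * suc n → d < suc (suc n + suc n)
      defect< {d} len = s≤s (+-cancelˡ-≤ (suc n + suc n) d (suc n + suc n)
        (≤-trans (+-monoˡ-≤ d k+k≤ℓ) (≤-reflexive (trans len (four n)))))
        where
          k+k≤ℓ : suc n + suc n ≤ ℓ
          k+k≤ℓ = subst (_≤ ℓ) (trans (cong ⌈_/2⌉ (four n)) (≡.sym (n≡⌈n+n/2⌉ (suc n + suc n)))) lo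

      length≡ℓ : ∀ {a d} → a + d ≡ 4 * suc n → ℓ + d ≡ 4 * suc n → a ≡ ℓ
      length≡ℓ {a} {d} a+d len = +-cancelʳ-≡ d a ℓ (trans a+d (≡.sym len))

      by-defect : ∀ {d} → Halves d → ℓ + d ≡ 4 * suc n → Realised ℓ
      by-defect (twice p) len with p ≤? n
      ... | yes p≤n = let r , p+r≡n = m≤n⇒∃[o]m+o≡n p≤n in
        realise evenDesign (evenDesign-valid _) p r p+r≡n
          (length≡ℓ (trans (even-length p r) (cong (λ x → 4 * suc x) p+r≡n)) len)
        where
          even-length : ∀ p r → 4 + (2 * p + 4 * r) + (p + p) ≡ 4 * suc (p + r)
          even-length = solve-∀
      ... | no p≰n = realise (minimalDesign _) (minimalDesign-valid _) 0 n refl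
          (length≡ℓ (trans (cong (λ x → 2 + (2 * 0 + 2 * n) + (x + x)) p≡k) (minimal-length n)) len)
        where
          minimal-length : ∀ n → 2 + (2 * 0 + 2 * n) + (suc n + suc n) ≡ 4 * suc n
          minimal-length = solve-∀
          p≡k : p ≡ suc n
          p≡k = ≤-antisym (≤-pred (m+m<n+n⇒m<n (<-≤-trans (defect< len) (s≤s (+-monoʳ-≤ (suc n) (n≤1+n (suc n)))))))
                          (≰⇒> p≰n)
      by-defect (twice+1 p) len = let r , p+r≡n = m≤n⇒∃[o]m+o≡n p≤n in
        realise oddDesign (oddDesign-valid _) p r p+r≡n
          (length≡ℓ (trans (odd-length p r) (cong (λ x → 4 * suc x) p+r≡n)) len)
        where
          odd-length : ∀ p r → 3 + (2 * p + 4 * r) + suc (p + p) ≡ 4 * suc (p + r)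
          odd-length = solve-∀
          p≤n : p ≤ n
          p≤n = ≤-pred (m+m<n+n⇒m<n (≤-pred (defect< len)))

omniversal-2m+q : ∀ m q → q ≤ 1 → 2 ≤ pred (2 * suc m + q) →
                  Omniversal (8 * suc m + 4 * q) (LStar (2 * suc m + q))
omniversal-2m+q m q q≤1 2≤n = subst (λ N → Omniversal N (LStar (2 * suc m + q))) (≡.sym (eight m q))
                                (omniversal-k≥3 {h = suc m + q} q≤1 (even m q) 2≤n)
  where
    eight : ∀ m q → 8 * suc m + 4 * q ≡ 4 * (2 * suc m + q)
    eight = solve-∀
    even : ∀ m q → 2 * suc m + q + q ≡ suc m + q + (suc m + q)
    even = solve-∀

theorem2p3 : (m q : ℕ) → 0 < m → q ≤ 1 → Omniversal (8 * m + 4 * q) (LStar (2 * m + q))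
theorem2p3 zero          _             ()  _
theorem2p3 (suc zero)    zero          _   _   = omniversal₂
theorem2p3 (suc zero)    (suc (suc _)) _   (s≤s ())
theorem2p3 (suc zero)    (suc zero)    _   q≤1 = omniversal-2m+q 0 1 q≤1 (s≤s (s≤s z≤n))
theorem2p3 (suc (suc m)) q             _   q≤1 =
  omniversal-2m+q (suc m) q q≤1 (≤-trans (s≤s (s≤s z≤n)) (≤-trans (m≤n+m _ (suc m)) (m≤m+n _ q)))
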